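{- Let $a_1, b_1, c_1, d_1, e_1, a_2, b_2, c_2, d_2 \in \mathbb{Z}$ with $a_1 \neq 0$, $b_1 \neq 0$, $a_2 \neq 0$. Then the system of equations $$a_1x^2 + b_1y^2 + c_1x + d_1y + e_1 = 0, \qquad a_2xy + b_2x + c_2y + d_2 = 0$$ has only finitely many integer solutions $(x, y)$. -}

module Defs where

open import Data.Integer using (ℤ; _+_; _*_; 0ℤ)
open import Data.Product using (_×_; _,_; ∃)
open import Data.List using (List)
open import Data.List.Membership.Propositional using (_∈_)
open import Relation.Binary.PropositionalEquality using (_≡_)

FinitelyMany : (ℤ → ℤ → Set) → Set
FinitelyMany P = ∃ λ (L : List (ℤ × ℤ)) → ∀ x y → P x y → (x , y) ∈ L

System : (a₁ b₁ c₁ d₁ e₁ a₂ b₂ c₂ d₂ : ℤ) → ℤ → ℤ → Set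
System a₁ b₁ c₁ d₁ e₁ a₂ b₂ c₂ d₂ x y =
  (a₁ * (x * x) + b₁ * (y * y) + c₁ * x + d₁ * y + e₁ ≡ 0ℤ)
  × (a₂ * (x * y) + b₂ * x + c₂ * y + d₂ ≡ 0ℤ)

-- Write u = a₂x + c₂ and v = a₂y + b₂. The second equation says exactly that
-- u v = c₂b₂ − a₂d₂. If v ≠ 0 this bounds |u|, hence |x|. If v = 0 then |y| ≤ |b₂|,
-- and the first equation, read as a quadratic in x with nonzero leading
-- coefficient a₁ and a constant term bounded in terms of |y|, bounds |x|.
-- Exchanging the roles of x and y bounds |y| in the same way.
module Submission where

open import Defs
open import Data.Integer using (ℤ; 0ℤ)
open import Relation.Binary.PropositionalEquality using (_≢_)

open import Data.Integer as ℤ using (+_; -_; _+_; _*_; _-_; ∣_∣; _≟_)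
open import Data.Integer.Properties as ℤ using (abs-*; ∣i-j∣≤∣i∣+∣j∣; ∣-i∣≡∣i∣; ∣i∣≡0⇒i≡0)
open import Data.Integer.Tactic.RingSolver using (solve-∀)
open import Algebra.Properties.AbelianGroup ℤ.+-0-abelianGroup using (inverseˡ-unique)
open import Data.List using (List; _++_; applyUpTo; cartesianProduct)
open import Data.List.Membership.Propositional using (_∈_)
open import Data.List.Membership.Propositional.Properties
  using (∈-++⁺ˡ; ∈-++⁺ʳ; ∈-applyUpTo⁺; ∈-cartesianProduct⁺)
open import Data.Nat as ℕ using (ℕ; zero; suc; _⊔_; _≤_; z≤n; s≤s; ≢-nonZero)
open import Data.Nat.Properties
  using ( ≤-trans; ≤-reflexive; module ≤-Reasoning; m≤m⊔n; m≤n⊔m; m≤m*n; m≤n*m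
        ; +-mono-≤; +-monoˡ-≤; +-monoʳ-≤; *-mono-≤; *-monoʳ-≤; *-cancelʳ-≤; *-distribʳ-+)
open import Data.Product using (_×_; _,_)
open import Function using (_∘_)
open import Relation.Binary.PropositionalEquality using (_≡_; sym; trans; cong; cong₂; module ≡-Reasoning)
open import Relation.Nullary using (yes; no)

range : ℕ → List ℤ
range n = applyUpTo +_ (suc n) ++ applyUpTo (-_ ∘ +_) (suc n)

∈-range : ∀ {n} z → ∣ z ∣ ≤ n → z ∈ range n
∈-range     (+ k)      k≤n   = ∈-++⁺ˡ (∈-applyUpTo⁺ +_ (s≤s k≤n))
∈-range {n} ℤ.-[1+ k ] 1+k≤n = ∈-++⁺ʳ (applyUpTo +_ (suc n)) (∈-applyUpTo⁺ (-_ ∘ +_) (s≤s 1+k≤n))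

finitelyMany-bounded : ∀ {P : ℤ → ℤ → Set} m n →
  (∀ x y → P x y → ∣ x ∣ ≤ m × ∣ y ∣ ≤ n) → FinitelyMany P
finitelyMany-bounded m n bounded = cartesianProduct (range m) (range n) , λ x y Pxy →
  let ∣x∣≤m , ∣y∣≤n = bounded x y Pxy
  in ∈-cartesianProduct⁺ (∈-range x ∣x∣≤m) (∈-range y ∣y∣≤n)

m*m≤n*m+k⇒m≤n+k : ∀ m n k → m ℕ.* m ≤ n ℕ.* m ℕ.+ k → m ≤ n ℕ.+ k
m*m≤n*m+k⇒m≤n+k zero       n k _       = z≤n
m*m≤n*m+k⇒m≤n+k m@(suc _) n k mm≤nm+k = *-cancelʳ-≤ m (n ℕ.+ k) m (begin
  m ℕ.* m                ≤⟨ mm≤nm+k ⟩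
  n ℕ.* m ℕ.+ k          ≤⟨ +-monoʳ-≤ (n ℕ.* m) (m≤m*n k m) ⟩
  n ℕ.* m ℕ.+ k ℕ.* m    ≡⟨ *-distribʳ-+ m n k ⟨
  (n ℕ.+ k) ℕ.* m        ∎)
  where open ≤-Reasoning

i+j≡0⇒∣i∣≡∣j∣ : ∀ i j → i + j ≡ 0ℤ → ∣ i ∣ ≡ ∣ j ∣
i+j≡0⇒∣i∣≡∣j∣ i j i+j≡0 = trans (cong ∣_∣ (inverseˡ-unique i j i+j≡0)) (∣-i∣≡∣i∣ j)

∣i∣≤∣j*i∣ : ∀ i {j} → j ≢ 0ℤ → ∣ i ∣ ≤ ∣ j * i ∣
∣i∣≤∣j*i∣ i {j} j≢0 = begin
  ∣ i ∣              ≤⟨ m≤n*m (∣ i ∣) (∣ j ∣) {{≢-nonZero (j≢0 ∘ ∣i∣≡0⇒i≡0)}} ⟩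
  ∣ j ∣ ℕ.* ∣ i ∣    ≡⟨ abs-* j i ⟨
  ∣ j * i ∣          ∎
  where open ≤-Reasoning

∣i∣≤∣j*i+k∣+∣k∣ : ∀ i {j} k → j ≢ 0ℤ → ∣ i ∣ ≤ ∣ j * i + k ∣ ℕ.+ ∣ k ∣
∣i∣≤∣j*i+k∣+∣k∣ i {j} k j≢0 = begin
  ∣ i ∣                      ≤⟨ ∣i∣≤∣j*i∣ i j≢0 ⟩
  ∣ j * i ∣                  ≡⟨ cong ∣_∣ (add-sub j i k) ⟩
  ∣ j * i + k - k ∣          ≤⟨ ∣i-j∣≤∣i∣+∣j∣ (j * i + k) k ⟩
  ∣ j * i + k ∣ ℕ.+ ∣ k ∣    ∎
  where
  open ≤-Reasoning
  add-sub : ∀ j i k → j * i ≡ j * i + k - k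
  add-sub = solve-∀

-- Since |a| ≥ 1 for a nonzero integer, the bound does not involve a.
quadratic-root-bound : ∀ {a} c k x → a ≢ 0ℤ →
  a * (x * x) + c * x + k ≡ 0ℤ → ∣ x ∣ ≤ ∣ c ∣ ℕ.+ ∣ k ∣
quadratic-root-bound {a} c k x a≢0 root = m*m≤n*m+k⇒m≤n+k (∣ x ∣) (∣ c ∣) (∣ k ∣) (begin
  ∣ x ∣ ℕ.* ∣ x ∣            ≡⟨ abs-* x x ⟨
  ∣ x * x ∣                  ≤⟨ ∣i∣≤∣j*i∣ (x * x) a≢0 ⟩
  ∣ a * (x * x) ∣            ≡⟨ i+j≡0⇒∣i∣≡∣j∣ (a * (x * x)) (c * x + k) root′ ⟩
  ∣ c * x + k ∣              ≤⟨ ℤ.∣i+j∣≤∣i∣+∣j∣ (c * x) k ⟩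
  ∣ c * x ∣ ℕ.+ ∣ k ∣        ≡⟨ cong (ℕ._+ ∣ k ∣) (abs-* c x) ⟩
  ∣ c ∣ ℕ.* ∣ x ∣ ℕ.+ ∣ k ∣  ∎)
  where
  open ≤-Reasoning
  root′ : a * (x * x) + (c * x + k) ≡ 0ℤ
  root′ = trans (sym (ℤ.+-assoc (a * (x * x)) (c * x) k)) root

quadratic-value-bound : ∀ a c e x {m} → ∣ x ∣ ≤ m →
  ∣ a * (x * x) + c * x + e ∣ ≤ ∣ a ∣ ℕ.* (m ℕ.* m) ℕ.+ ∣ c ∣ ℕ.* m ℕ.+ ∣ e ∣
quadratic-value-bound a c e x {m} ∣x∣≤m = begin
  ∣ a * (x * x) + c * x + e ∣
    ≤⟨ ℤ.∣i+j∣≤∣i∣+∣j∣ (a * (x * x) + c * x) e ⟩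
  ∣ a * (x * x) + c * x ∣ ℕ.+ ∣ e ∣
    ≤⟨ +-monoˡ-≤ ∣ e ∣ (ℤ.∣i+j∣≤∣i∣+∣j∣ (a * (x * x)) (c * x)) ⟩
  ∣ a * (x * x) ∣ ℕ.+ ∣ c * x ∣ ℕ.+ ∣ e ∣
    ≡⟨ cong₂ (λ s t → s ℕ.+ t ℕ.+ ∣ e ∣)
         (trans (abs-* a (x * x)) (cong (∣ a ∣ ℕ.*_) (abs-* x x))) (abs-* c x) ⟩
  ∣ a ∣ ℕ.* (∣ x ∣ ℕ.* ∣ x ∣) ℕ.+ ∣ c ∣ ℕ.* ∣ x ∣ ℕ.+ ∣ e ∣
    ≤⟨ +-monoˡ-≤ ∣ e ∣ (+-mono-≤ (*-monoʳ-≤ ∣ a ∣ (*-mono-≤ ∣x∣≤m ∣x∣≤m))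
                                 (*-monoʳ-≤ ∣ c ∣ ∣x∣≤m)) ⟩
  ∣ a ∣ ℕ.* (m ℕ.* m) ℕ.+ ∣ c ∣ ℕ.* m ℕ.+ ∣ e ∣
    ∎
  where open ≤-Reasoning

hyperbola-factorisation : ∀ a b c d x y → a * (x * y) + b * x + c * y + d ≡ 0ℤ →
  (a * x + c) * (a * y + b) ≡ c * b - a * d
hyperbola-factorisation a b c d x y on-curve = begin
  (a * x + c) * (a * y + b)                              ≡⟨ expand a b c d x y ⟩
  a * (a * (x * y) + b * x + c * y + d) + (c * b - a * d) ≡⟨ cong (λ t → a * t + (c * b - a * d)) on-curve ⟩
  a * 0ℤ + (c * b - a * d)                               ≡⟨ cong (_+ (c * b - a * d)) (ℤ.*-zeroʳ a) ⟩
  0ℤ + (c * b - a * d)                                   ≡⟨ ℤ.+-identityˡ (c * b - a * d) ⟩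
  c * b - a * d                                          ∎
  where
  open ≡-Reasoning
  expand : ∀ a b c d x y →
    (a * x + c) * (a * y + b) ≡ a * (a * (x * y) + b * x + c * y + d) + (c * b - a * d)
  expand = solve-∀

hyperbola-x-bound : ∀ {a} b c d x y → a ≢ 0ℤ → a * y + b ≢ 0ℤ →
  a * (x * y) + b * x + c * y + d ≡ 0ℤ → ∣ x ∣ ≤ ∣ c * b - a * d ∣ ℕ.+ ∣ c ∣
hyperbola-x-bound {a} b c d x y a≢0 v≢0 on-curve = begin
  ∣ x ∣                                    ≤⟨ ∣i∣≤∣j*i+k∣+∣k∣ x c a≢0 ⟩
  ∣ a * x + c ∣ ℕ.+ ∣ c ∣                  ≤⟨ +-monoˡ-≤ ∣ c ∣ (∣i∣≤∣j*i∣ (a * x + c) v≢0) ⟩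
  ∣ (a * y + b) * (a * x + c) ∣ ℕ.+ ∣ c ∣  ≡⟨ cong (λ t → ∣ t ∣ ℕ.+ ∣ c ∣) uv≡N ⟩
  ∣ c * b - a * d ∣ ℕ.+ ∣ c ∣              ∎
  where
  open ≤-Reasoning
  uv≡N : (a * y + b) * (a * x + c) ≡ c * b - a * d
  uv≡N = trans (ℤ.*-comm (a * y + b) (a * x + c)) (hyperbola-factorisation a b c d x y on-curve)

xBound : (a₁ b₁ c₁ d₁ e₁ a₂ b₂ c₂ d₂ : ℤ) → ℕ
xBound a₁ b₁ c₁ d₁ e₁ a₂ b₂ c₂ d₂ =
  (∣ c₂ * b₂ - a₂ * d₂ ∣ ℕ.+ ∣ c₂ ∣)
  ⊔ (∣ c₁ ∣ ℕ.+ (∣ b₁ ∣ ℕ.* (∣ b₂ ∣ ℕ.* ∣ b₂ ∣) ℕ.+ ∣ d₁ ∣ ℕ.* ∣ b₂ ∣ ℕ.+ ∣ e₁ ∣))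

system-x-bound : ∀ a₁ b₁ c₁ d₁ e₁ a₂ b₂ c₂ d₂ x y → a₁ ≢ 0ℤ → a₂ ≢ 0ℤ →
  System a₁ b₁ c₁ d₁ e₁ a₂ b₂ c₂ d₂ x y → ∣ x ∣ ≤ xBound a₁ b₁ c₁ d₁ e₁ a₂ b₂ c₂ d₂
system-x-bound a₁ b₁ c₁ d₁ e₁ a₂ b₂ c₂ d₂ x y a₁≢0 a₂≢0 (conic , hyperbola)
  with a₂ * y + b₂ ≟ 0ℤ
... | no v≢0  = ≤-trans (hyperbola-x-bound b₂ c₂ d₂ x y a₂≢0 v≢0 hyperbola) (m≤m⊔n _ _)
... | yes v≡0 = ≤-trans (≤-trans ∣x∣≤∣c₁∣+∣k∣ (+-monoʳ-≤ ∣ c₁ ∣ ∣k∣-bound)) (m≤n⊔m _ _)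
  where
  k : ℤ
  k = b₁ * (y * y) + d₁ * y + e₁

  quadratic-in-x : ∀ a₁ b₁ c₁ d₁ e₁ x y →
    a₁ * (x * x) + b₁ * (y * y) + c₁ * x + d₁ * y + e₁ ≡
    a₁ * (x * x) + c₁ * x + (b₁ * (y * y) + d₁ * y + e₁)
  quadratic-in-x = solve-∀

  ∣x∣≤∣c₁∣+∣k∣ : ∣ x ∣ ≤ ∣ c₁ ∣ ℕ.+ ∣ k ∣
  ∣x∣≤∣c₁∣+∣k∣ = quadratic-root-bound c₁ k x a₁≢0
    (trans (sym (quadratic-in-x a₁ b₁ c₁ d₁ e₁ x y)) conic)

  ∣y∣≤∣b₂∣ : ∣ y ∣ ≤ ∣ b₂ ∣
  ∣y∣≤∣b₂∣ = ≤-trans (∣i∣≤∣j*i+k∣+∣k∣ y b₂ a₂≢0)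
    (≤-reflexive (cong (λ t → ∣ t ∣ ℕ.+ ∣ b₂ ∣) v≡0))

  ∣k∣-bound : ∣ k ∣ ≤ ∣ b₁ ∣ ℕ.* (∣ b₂ ∣ ℕ.* ∣ b₂ ∣) ℕ.+ ∣ d₁ ∣ ℕ.* ∣ b₂ ∣ ℕ.+ ∣ e₁ ∣
  ∣k∣-bound = quadratic-value-bound b₁ d₁ e₁ y ∣y∣≤∣b₂∣

system-swap : ∀ a₁ b₁ c₁ d₁ e₁ a₂ b₂ c₂ d₂ x y →
  System a₁ b₁ c₁ d₁ e₁ a₂ b₂ c₂ d₂ x y → System b₁ a₁ d₁ c₁ e₁ a₂ c₂ b₂ d₂ y x
system-swap a₁ b₁ c₁ d₁ e₁ a₂ b₂ c₂ d₂ x y (conic , hyperbola) =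
  trans (swap-conic a₁ b₁ c₁ d₁ e₁ x y) conic , trans (swap-hyperbola a₂ b₂ c₂ d₂ x y) hyperbola
  where
  swap-conic : ∀ a₁ b₁ c₁ d₁ e₁ x y →
    b₁ * (y * y) + a₁ * (x * x) + d₁ * y + c₁ * x + e₁ ≡
    a₁ * (x * x) + b₁ * (y * y) + c₁ * x + d₁ * y + e₁
  swap-conic = solve-∀
  swap-hyperbola : ∀ a₂ b₂ c₂ d₂ x y →
    a₂ * (y * x) + c₂ * y + b₂ * x + d₂ ≡ a₂ * (x * y) + b₂ * x + c₂ * y + d₂
  swap-hyperbola = solve-∀

lemma2p4 : (a₁ b₁ c₁ d₁ e₁ a₂ b₂ c₂ d₂ : ℤ) → a₁ ≢ 0ℤ → b₁ ≢ 0ℤ → a₂ ≢ 0ℤ →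
    FinitelyMany (System a₁ b₁ c₁ d₁ e₁ a₂ b₂ c₂ d₂)
lemma2p4 a₁ b₁ c₁ d₁ e₁ a₂ b₂ c₂ d₂ a₁≢0 b₁≢0 a₂≢0 =
  finitelyMany-bounded (xBound a₁ b₁ c₁ d₁ e₁ a₂ b₂ c₂ d₂) (xBound b₁ a₁ d₁ c₁ e₁ a₂ c₂ b₂ d₂)
    λ x y solution →
        system-x-bound a₁ b₁ c₁ d₁ e₁ a₂ b₂ c₂ d₂ x y a₁≢0 a₂≢0 solution
      , system-x-bound b₁ a₁ d₁ c₁ e₁ a₂ c₂ b₂ d₂ y x b₁≢0 a₂≢0
          (system-swap a₁ b₁ c₁ d₁ e₁ a₂ b₂ c₂ d₂ x y solution)
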